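{- Let $E$ be a finite set with a total order $\preceq$, and let $\mathcal{C}\subseteq 2^E$ be a clutter (no member of $\mathcal{C}$ contains another member). Then the size of the ZDD $\mathsf{Z}(\mathcal{C})$ with respect to $(E,\preceq)$ is at most the size of the BDD $\mathsf{B}(\mathcal{C})$ with respect to $(E,\preceq)$.
   Context: A decision diagram over $(E,\preceq)$ is a directed acyclic graph with a unique root (indegree $0$), at most two terminal nodes (outdegree $0$), the 0-terminal $\bot$ and the 1-terminal $\top$, and non-terminal nodes $\nu$, each with a label $\ell(\nu)\in E$ and exactly two outgoing arcs, the 0-arc $(\nu,\nu_0)$ and the 1-arc $(\nu,\nu_1)$, with $\ell(\nu)\prec\ell(\nu_0)$ and $\ell(\nu)\prec\ell(\nu_1)$ (terminal labels are regarded as larger than all elements of $E$). A 1-path is a directed path from the root to $\top$. The BDD $\mathsf{B}(\mathcal{S})$ (resp. ZDD $\mathsf{Z}(\mathcal{S})$) of $\mathcal{S}\subseteq 2^E$ is the unique diagram obtained from the complete binary decision tree of $\mathcal{S}$ (internal nodes at depth $j$ labeled by the $(j+1)$-th smallest element of $E$; the leaf reached by taking 1-arcs exactly at the elements of $X$ is $\top$ iff $X\in\mathcal{S}$, else $\bot$) by exhaustively applying: (NS) merge non-terminal nodes having the same label, the same 0-successor and the same 1-successor; and, for BDDs, (B-ND) remove every non-terminal $\nu$ with $\nu_0=\nu_1$, redirecting arcs entering $\nu$ to $\nu_0$; for ZDDs, (Z-ND) remove every non-terminal $\nu$ with $\nu_1=\bot$, redirecting arcs entering $\nu$ to $\nu_0$.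 The size of a BDD/ZDD is its number of non-terminal nodes. -}

module Defs where

open import Data.Nat using (ℕ; zero; suc)
open import Data.Bool using (Bool; true; false; if_then_else_)
open import Data.Fin using (Fin; zero; suc)
open import Data.Fin.Properties using (suc-injective) renaming (_≟_ to _≟F_)
open import Data.Fin.Subset using (Subset; _⊆_)
open import Data.Vec using (Vec; []; _∷_)
open import Data.List using (List; []; _∷_; _++_; length; deduplicate)
open import Relation.Binary.PropositionalEquality using (_≡_; refl; cong)
open import Relation.Nullary using (Dec; yes; no)
open import Function using (_∘_)

-- Ground set E = Fin n with its natural total order (every finite totally
-- ordered set is order-isomorphic to such a Fin n).
Family : ℕ → Set
Family n = Subset n → Bool

IsClutter : ∀ {n} → Family n → Set
IsClutter {n} C = (X Y : Subset n) → C X ≡ true → C Y ≡ true → X ⊆ Y → X ≡ Y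

-- Decision diagrams in term form: a DAG is represented by its unfolding;
-- maximal sharing (rule NS) corresponds to identifying structurally equal
-- subterms, which is how size is counted below.
data DD (n : ℕ) : Set where
  bot : DD n
  top : DD n
  node : Fin n → DD n → DD n → DD n   -- label, 0-successor, 1-successor

node-inj₁ : ∀ {n i j} {a b c d : DD n} → node i a b ≡ node j c d → i ≡ j
node-inj₁ refl = refl
node-inj₂ : ∀ {n i j} {a b c d : DD n} → node i a b ≡ node j c d → a ≡ c
node-inj₂ refl = refl
node-inj₃ : ∀ {n i j} {a b c d : DD n} → node i a b ≡ node j c d → b ≡ d
node-inj₃ refl = refl

_≟DD_ : ∀ {n} (x y : DD n) → Dec (x ≡ y)
bot ≟DD bot = yes refl
bot ≟DD top = no λ ()
bot ≟DD node _ _ _ = no λ ()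
top ≟DD bot = no λ ()
top ≟DD top = yes refl
top ≟DD node _ _ _ = no λ ()
node _ _ _ ≟DD bot = no λ ()
node _ _ _ ≟DD top = no λ ()
node i a b ≟DD node j c d with i ≟F j | a ≟DD c | b ≟DD d
... | yes refl | yes refl | yes refl = yes refl
... | no p | _ | _ = no (p ∘ node-inj₁)
... | yes _ | no p | _ = no (p ∘ node-inj₂)
... | yes _ | yes _ | no p = no (p ∘ node-inj₃)

liftDD : ∀ {n} → DD n → DD (suc n)
liftDD bot = bot
liftDD top = top
liftDD (node i a b) = node (suc i) (liftDD a) (liftDD b)

tree : ∀ {n} → Family n → DD n
tree {zero} S = if S [] then top else bot
tree {suc n} S = node zero (liftDD (tree (S ∘ (false ∷_))))
                           (liftDD (tree (S ∘ (true ∷_))))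

mkB : ∀ {n} → Fin n → DD n → DD n → DD n
mkB i a b with a ≟DD b
... | yes _ = a
... | no _ = node i a b

mkZ : ∀ {n} → Fin n → DD n → DD n → DD n
mkZ i a bot = a
mkZ i a top = node i a top
mkZ i a b@(node _ _ _) = node i a b

reduceWith : ∀ {n} → (Fin n → DD n → DD n → DD n) → DD n → DD n
reduceWith mk bot = bot
reduceWith mk top = top
reduceWith mk (node i a b) = mk i (reduceWith mk a) (reduceWith mk b)

nodes : ∀ {n} → DD n → List (DD n)
nodes bot = []
nodes top = []
nodes d@(node i a b) = d ∷ (nodes a ++ nodes b)

size : ∀ {n} → DD n → ℕ
size d = length (deduplicate _≟DD_ (nodes d))

BDD ZDD : ∀ {n} → Family n → DD n
BDD S = reduceWith mkB (tree S)
ZDD S = reduceWith mkZ (tree S)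

-- Reducing the BDD of a clutter C by the ZDD rule gives exactly its ZDD: the
-- BDD rule only removes a node when both cofactors of C agree, and for a
-- clutter this forces the 1-cofactor to be empty, so the ZDD rule would have
-- removed that node anyway. Every node of a ZDD-reduction of a diagram is the
-- image of a node of that diagram, so ZDD-reduction cannot increase the size.
module Submission where

open import Defs
open import Data.Nat using (ℕ; _≤_; zero; suc; z≤n; s≤s)
open import Data.Nat.Properties using (≤-trans; ≤-reflexive)
open import Data.Bool using (Bool; true; false; if_then_else_)
open import Data.Fin using (Fin; zero; suc)
open import Data.Fin.Properties using (suc-injective)
open import Data.Fin.Subset using (Subset; _⊆_)
open import Data.Vec as Vec using ([]; _∷_)
open import Data.List using (List; []; _∷_; _++_; map; length; filter; deduplicate)
open import Data.List.Properties using (filter-notAll; length-map; map-++)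
open import Data.List.Relation.Unary.Any as Any using (here; there)
open import Data.List.Relation.Unary.All using (lookup)
open import Data.List.Relation.Unary.AllPairs using (_∷_)
open import Data.List.Relation.Unary.Unique.Propositional using (Unique)
open import Data.List.Relation.Unary.Unique.DecPropositional.Properties using (deduplicate-!)
open import Data.List.Relation.Binary.Subset.Propositional using () renaming (_⊆_ to _⊆ₗ_)
open import Data.List.Relation.Binary.Subset.Propositional.Properties using (++⁺)
open import Data.List.Membership.Propositional using (_∈_)
open import Data.List.Membership.Propositional.Properties
  using (∈-map⁺; ∈-map⁻; ∈-filter⁺; ∈-deduplicate⁺; ∈-deduplicate⁻; ∈-++⁺ˡ)
open import Data.Product using (_,_)
open import Data.Empty using (⊥-elim)
open import Relation.Nullary using (Dec; yes; no; ¬?)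
open import Relation.Binary.PropositionalEquality
open import Function using (_∘_; id)

open ≡-Reasoning

module _ {A : Set} (_≟_ : (x y : A) → Dec (x ≡ y)) where

  Unique-⊆⇒length-≤ : ∀ {xs ys : List A} → Unique xs → xs ⊆ₗ ys → length xs ≤ length ys
  Unique-⊆⇒length-≤ {[]} _ _ = z≤n
  Unique-⊆⇒length-≤ {x ∷ xs} {ys} (x∉xs ∷ uxs) xxs⊆ys =
    ≤-trans (s≤s (Unique-⊆⇒length-≤ uxs xs⊆ys∖x))
            (filter-notAll (¬? ∘ (x ≟_)) ys (Any.map (λ x≡y x≢y → x≢y x≡y) (xxs⊆ys (here refl))))
    where
    xs⊆ys∖x : xs ⊆ₗ filter (¬? ∘ (x ≟_)) ys
    xs⊆ys∖x z∈xs = ∈-filter⁺ (¬? ∘ (x ≟_)) (xxs⊆ys (there z∈xs)) (lookup x∉xs z∈xs)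

  length-deduplicate-map-≤ : ∀ (f : A → A) {xs ys : List A} → xs ⊆ₗ map f ys →
    length (deduplicate _≟_ xs) ≤ length (deduplicate _≟_ ys)
  length-deduplicate-map-≤ f {xs} {ys} xs⊆fys =
    ≤-trans (Unique-⊆⇒length-≤ (deduplicate-! _≟_ xs) dedup⊆)
            (≤-reflexive (length-map f (deduplicate _≟_ ys)))
    where
    dedup⊆ : deduplicate _≟_ xs ⊆ₗ map f (deduplicate _≟_ ys)
    dedup⊆ z∈ with ∈-map⁻ f (xs⊆fys (∈-deduplicate⁻ _≟_ xs z∈))
    ... | y , y∈ys , refl = ∈-map⁺ f (∈-deduplicate⁺ _≟_ y∈ys)

liftDD-injective : ∀ {n} {a b : DD n} → liftDD a ≡ liftDD b → a ≡ b
liftDD-injective {a = bot} {bot} _ = refl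
liftDD-injective {a = top} {top} _ = refl
liftDD-injective {a = node i a₀ a₁} {node j b₀ b₁} eq
  rewrite suc-injective (node-inj₁ eq)
        | liftDD-injective (node-inj₂ eq)
        | liftDD-injective (node-inj₃ eq) = refl
liftDD-injective {a = bot} {top} ()
liftDD-injective {a = bot} {node _ _ _} ()
liftDD-injective {a = top} {bot} ()
liftDD-injective {a = top} {node _ _ _} ()
liftDD-injective {a = node _ _ _} {bot} ()
liftDD-injective {a = node _ _ _} {top} ()

reduceWith-liftDD : (mk : ∀ {n} → Fin n → DD n → DD n → DD n) →
  (∀ {n} i (a b : DD n) → mk (suc i) (liftDD a) (liftDD b) ≡ liftDD (mk i a b)) →
  ∀ {n} (d : DD n) → reduceWith mk (liftDD d) ≡ liftDD (reduceWith mk d)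
reduceWith-liftDD mk mk-lift bot = refl
reduceWith-liftDD mk mk-lift top = refl
reduceWith-liftDD mk mk-lift (node i a b)
  rewrite reduceWith-liftDD mk mk-lift a | reduceWith-liftDD mk mk-lift b =
  mk-lift i (reduceWith mk a) (reduceWith mk b)

reduceB reduceZ : ∀ {n} → DD n → DD n
reduceB = reduceWith mkB
reduceZ = reduceWith mkZ

reduceB-liftDD : ∀ {n} (d : DD n) → reduceB (liftDD d) ≡ liftDD (reduceB d)
reduceB-liftDD = reduceWith-liftDD mkB mkB-liftDD
  where
  mkB-liftDD : ∀ {n} i (a b : DD n) → mkB (suc i) (liftDD a) (liftDD b) ≡ liftDD (mkB i a b)
  mkB-liftDD i a b with liftDD a ≟DD liftDD b | a ≟DD b
  ... | yes _    | yes _    = refl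
  ... | yes la≡lb | no a≢b  = ⊥-elim (a≢b (liftDD-injective la≡lb))
  ... | no la≢lb | yes refl = ⊥-elim (la≢lb refl)
  ... | no _     | no _     = refl

reduceZ-liftDD : ∀ {n} (d : DD n) → reduceZ (liftDD d) ≡ liftDD (reduceZ d)
reduceZ-liftDD = reduceWith-liftDD mkZ mkZ-liftDD
  where
  mkZ-liftDD : ∀ {n} i (a b : DD n) → mkZ (suc i) (liftDD a) (liftDD b) ≡ liftDD (mkZ i a b)
  mkZ-liftDD i a bot = refl
  mkZ-liftDD i a top = refl
  mkZ-liftDD i a (node _ _ _) = refl

cofactor : ∀ {n} → Family (suc n) → Bool → Family n
cofactor S b = S ∘ (b ∷_)

⟦_⟧ : ∀ {n} → DD n → Family n
⟦ bot ⟧ X = false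
⟦ top ⟧ X = true
⟦ node i a b ⟧ X = if Vec.lookup X i then ⟦ b ⟧ X else ⟦ a ⟧ X

⟦liftDD⟧ : ∀ {n} (d : DD n) x X → ⟦ liftDD d ⟧ (x ∷ X) ≡ ⟦ d ⟧ X
⟦liftDD⟧ bot x X = refl
⟦liftDD⟧ top x X = refl
⟦liftDD⟧ (node i a b) x X rewrite ⟦liftDD⟧ a x X | ⟦liftDD⟧ b x X = refl

⟦tree⟧ : ∀ {n} (S : Family n) X → ⟦ tree S ⟧ X ≡ S X
⟦tree⟧ {zero} S [] with S []
... | true = refl
... | false = refl
⟦tree⟧ {suc n} S (x ∷ X) with x
... | true  = trans (⟦liftDD⟧ (tree (cofactor S true)) true X) (⟦tree⟧ (cofactor S true) X)
... | false = trans (⟦liftDD⟧ (tree (cofactor S false)) false X) (⟦tree⟧ (cofactor S false) X)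

⟦reduceWith⟧ : ∀ {n} (mk : Fin n → DD n → DD n → DD n) →
  (∀ i a b X → ⟦ mk i a b ⟧ X ≡ ⟦ node i a b ⟧ X) →
  ∀ d X → ⟦ reduceWith mk d ⟧ X ≡ ⟦ d ⟧ X
⟦reduceWith⟧ mk sound bot X = refl
⟦reduceWith⟧ mk sound top X = refl
⟦reduceWith⟧ mk sound (node i a b) X
  rewrite sound i (reduceWith mk a) (reduceWith mk b) X
        | ⟦reduceWith⟧ mk sound a X | ⟦reduceWith⟧ mk sound b X = refl

⟦mkB⟧ : ∀ {n} i (a b : DD n) X → ⟦ mkB i a b ⟧ X ≡ ⟦ node i a b ⟧ X
⟦mkB⟧ i a b X with a ≟DD b
... | no _ = refl
... | yes refl with Vec.lookup X i
...   | true = refl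
...   | false = refl

⟦BDD⟧ : ∀ {n} (S : Family n) X → ⟦ BDD S ⟧ X ≡ S X
⟦BDD⟧ S X = trans (⟦reduceWith⟧ mkB ⟦mkB⟧ (tree S) X) (⟦tree⟧ S X)

BDD-injective : ∀ {n} {S T : Family n} → BDD S ≡ BDD T → ∀ X → S X ≡ T X
BDD-injective {S = S} {T} eq X = begin
  S X         ≡⟨ ⟦BDD⟧ S X ⟨
  ⟦ BDD S ⟧ X ≡⟨ cong (λ d → ⟦ d ⟧ X) eq ⟩
  ⟦ BDD T ⟧ X ≡⟨ ⟦BDD⟧ T X ⟩
  T X         ∎

ZDD-empty : ∀ {n} (S : Family n) → (∀ X → S X ≡ false) → ZDD S ≡ bot
ZDD-empty {zero} S empty rewrite empty [] = refl
ZDD-empty {suc n} S empty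
  rewrite reduceZ-liftDD (tree (cofactor S false)) | reduceZ-liftDD (tree (cofactor S true))
        | ZDD-empty (cofactor S false) (empty ∘ (false ∷_))
        | ZDD-empty (cofactor S true) (empty ∘ (true ∷_)) = refl

cofactor-clutter : ∀ {n} {C : Family (suc n)} → IsClutter C → ∀ b → IsClutter (cofactor C b)
cofactor-clutter clutter b X Y X∈C Y∈C X⊆Y = cong Vec.tail (clutter _ _ X∈C Y∈C ∷-⊆)
  where
  ∷-⊆ : (b ∷ X) ⊆ (b ∷ Y)
  ∷-⊆ Vec.here = Vec.here
  ∷-⊆ (Vec.there x∈X) = Vec.there (X⊆Y x∈X)

⊆-insert-zero : ∀ {n} (X : Subset n) → (false ∷ X) ⊆ (true ∷ X)
⊆-insert-zero X (Vec.there x∈X) = Vec.there x∈X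

clutter-equal-cofactors⇒empty : ∀ {n} {C : Family (suc n)} → IsClutter C →
  (∀ X → cofactor C false X ≡ cofactor C true X) → ∀ X → cofactor C true X ≡ false
clutter-equal-cofactors⇒empty {C = C} clutter same X with C (true ∷ X) in X₁∈C
... | false = refl
... | true with () ← clutter (false ∷ X) (true ∷ X) (trans (same X) X₁∈C) X₁∈C (⊆-insert-zero X)

reduceZ-mkB : ∀ {n} i (a b : DD n) → (a ≡ b → reduceZ b ≡ bot) →
  reduceZ (mkB i a b) ≡ reduceZ (node i a b)
reduceZ-mkB i a b merged⇒empty with a ≟DD b
... | yes refl rewrite merged⇒empty refl = refl
... | no _ = refl

reduceZ-BDD : ∀ {n} (C : Family n) → IsClutter C → reduceZ (BDD C) ≡ ZDD C
reduceZ-BDD {zero} C _ with C []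
... | true = refl
... | false = refl
reduceZ-BDD {suc n} C clutter = begin
  reduceZ (mkB zero (branchB false) (branchB true))
    ≡⟨ reduceZ-mkB zero (branchB false) (branchB true) merged⇒empty ⟩
  mkZ zero (reduceZ (branchB false)) (reduceZ (branchB true))
    ≡⟨ cong₂ (mkZ zero) (reduceZ-branchB false) (reduceZ-branchB true) ⟩
  mkZ zero (reduceZ (branch false)) (reduceZ (branch true)) ∎
  where
  branch branchB : Bool → DD (suc n)
  branch b = liftDD (tree (cofactor C b))
  branchB b = reduceB (branch b)

  reduceZ-branchB : ∀ b → reduceZ (branchB b) ≡ reduceZ (branch b)
  reduceZ-branchB b = begin
    reduceZ (branchB b)                       ≡⟨ cong reduceZ (reduceB-liftDD (tree (cofactor C b))) ⟩
    reduceZ (liftDD (BDD (cofactor C b)))     ≡⟨ reduceZ-liftDD (BDD (cofactor C b)) ⟩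
    liftDD (reduceZ (BDD (cofactor C b)))     ≡⟨ cong liftDD (reduceZ-BDD (cofactor C b) (cofactor-clutter clutter b)) ⟩
    liftDD (ZDD (cofactor C b))               ≡⟨ reduceZ-liftDD (tree (cofactor C b)) ⟨
    reduceZ (branch b)                        ∎

  merged⇒empty : branchB false ≡ branchB true → reduceZ (branchB true) ≡ bot
  merged⇒empty merged = begin
    reduceZ (branchB true)                    ≡⟨ reduceZ-branchB true ⟩
    reduceZ (branch true)                     ≡⟨ reduceZ-liftDD (tree (cofactor C true)) ⟩
    liftDD (ZDD (cofactor C true))            ≡⟨ cong liftDD (ZDD-empty (cofactor C true) cofactor-true-empty) ⟩
    bot                                       ∎
    where
    cofactor-true-empty : ∀ X → cofactor C true X ≡ false
    cofactor-true-empty = clutter-equal-cofactors⇒empty clutter (BDD-injective (liftDD-injective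
      (trans (sym (reduceB-liftDD (tree (cofactor C false))))
             (trans merged (reduceB-liftDD (tree (cofactor C true)))))))

nodes-mkZ : ∀ {n} i (a b : DD n) → nodes (mkZ i a b) ⊆ₗ mkZ i a b ∷ nodes a ++ nodes b
nodes-mkZ i a bot = there ∘ ∈-++⁺ˡ
nodes-mkZ i a top = id
nodes-mkZ i a (node _ _ _) = id

nodes-reduceZ : ∀ {n} (d : DD n) → nodes (reduceZ d) ⊆ₗ map reduceZ (nodes d)
nodes-reduceZ (node i a b) z∈ with nodes-mkZ i (reduceZ a) (reduceZ b) z∈
... | here z≡root = here z≡root
... | there z∈ab = there (subst (_ ∈_) (sym (map-++ reduceZ (nodes a) (nodes b)))
                                 (++⁺ (nodes-reduceZ a) (nodes-reduceZ b) z∈ab))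

size-reduceZ : ∀ {n} (d : DD n) → size (reduceZ d) ≤ size d
size-reduceZ d = length-deduplicate-map-≤ _≟DD_ reduceZ (nodes-reduceZ d)

theorem3p3 : (n : ℕ) (C : Family n) → IsClutter C → size (ZDD C) ≤ size (BDD C)
theorem3p3 n C clutter =
  subst (λ d → size d ≤ size (BDD C)) (reduceZ-BDD C clutter) (size-reduceZ (BDD C))
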